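{- Let $F$ be an unsatisfiable hitting clause-set and $F'\subseteq F$ a nonempty subset, and let $F'':=(F\setminus F')\cup\{\bigcap F'\}$. The following are equivalent: (1) $F'$ is a clause-factor of $F$; (2) $F''$ is a hitting clause-set (i.e., $\bigcap F'$ clashes with every clause in $F\setminus F'$); (3) $F''$ is an unsatisfiable hitting clause-set.
   Context: Literals are nonzero integers, the complement of $x$ is $\overline{x}=-x$. A clause is a finite set of literals with no pair $x,\overline{x}$; a clause-set is a finite set of clauses. $F$ is satisfiable if some clause meets every clause of $F$, otherwise unsatisfiable. $F$ is hitting if any two distinct clauses $C,D\in F$ clash, i.e., have some $x\in C$ with $\overline{x}\in D$. A nonempty clause-set $F'$ is a clause-factor if $\{D\setminus\bigcap F':D\in F'\}$ is unsatisfiable; a clause-factor of $F$ is a subset of $F$ which is a clause-factor. -}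

module Defs where

open import Data.Integer using (ℤ; -_; 0ℤ; _≟_)
open import Data.List using (List; []; _∷_; [_]; filter; _++_; map)
open import Data.List.Relation.Unary.All as All using (All)
open import Data.List.Relation.Unary.Any as Any using (Any)
open import Data.List.Membership.Propositional using (_∈_; _∉_)
open import Data.List.Membership.DecPropositional _≟_ using (_∈?_)
open import Data.List.Relation.Binary.Subset.DecPropositional _≟_ using (_⊆_; _⊆?_)
open import Data.Product using (_×_; ∃; ∃-syntax; _,_)
open import Relation.Nullary using (¬_; Dec; yes; no)
open import Relation.Nullary.Decidable using (_×-dec_; ¬?)
open import Relation.Binary.PropositionalEquality using (_≢_)

-- Literals are (nonzero) integers; the complement of x is - x.
Lit : Set
Lit = ℤ

-- A clause is represented by a list of literals (read as the finite set of its elements).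
Clause : Set
Clause = List Lit

-- A clause-set is represented by a list of clauses (read as a finite set of clauses,
-- two clauses being equal iff they have the same elements).
ClauseSet : Set
ClauseSet = List Clause

IsClause : Clause → Set
IsClause C = All (λ x → x ≢ 0ℤ) C × (∀ x → x ∈ C → - x ∉ C)

IsClauseSet : ClauseSet → Set
IsClauseSet F = All IsClause F

_≐_ : Clause → Clause → Set
C ≐ D = C ⊆ D × D ⊆ C

_≐?_ : (C D : Clause) → Dec (C ≐ D)
C ≐? D = (C ⊆? D) ×-dec (D ⊆? C)

_∈ₛ_ : Clause → ClauseSet → Set
D ∈ₛ F = Any (λ E → E ≐ D) F

_∈ₛ?_ : (D : Clause) → (F : ClauseSet) → Dec (D ∈ₛ F)
D ∈ₛ? F = Any.any? (λ E → E ≐? D) F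

Meets : Clause → Clause → Set
Meets C D = ∃[ x ] (x ∈ C × x ∈ D)

Satisfiable : ClauseSet → Set
Satisfiable F = ∃[ C ] (IsClause C × (∀ D → D ∈ F → Meets C D))

Unsatisfiable : ClauseSet → Set
Unsatisfiable F = ¬ Satisfiable F

Clash : Clause → Clause → Set
Clash C D = ∃[ x ] (x ∈ C × - x ∈ D)

Hitting : ClauseSet → Set
Hitting F = ∀ C D → C ∈ F → D ∈ F → ¬ (C ≐ D) → Clash C D

-- Intersection of all clauses of a nonempty clause-set
-- (the value on [] is irrelevant; it is only used for nonempty F).
⋂ : ClauseSet → Clause
⋂ []       = []
⋂ (C ∷ Fs) = filter (λ x → All.all? (λ D → x ∈? D) Fs) C

_∖ᶜ_ : Clause → Clause → Clause
D ∖ᶜ C = filter (λ x → ¬? (x ∈? C)) D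

IsClauseFactor : ClauseSet → Set
IsClauseFactor F' = (F' ≢ []) × Unsatisfiable (map (λ D → D ∖ᶜ ⋂ F') F')

_∖ₛ_ : ClauseSet → ClauseSet → ClauseSet
F ∖ₛ F' = filter (λ D → ¬? (D ∈ₛ? F')) F

contractFactor : ClauseSet → ClauseSet → ClauseSet
contractFactor F F' = (F ∖ₛ F') ++ [ ⋂ F' ]

-- Write I = ⋂ F'.  If F' is a clause-factor, a clause E ∈ F ∖ F' not clashing with I would
-- give the satisfying clause ¬E of {D ∖ I : D ∈ F'}: E clashes with each D ∈ F' in a literal
-- outside I.  Conversely, if I clashes with all of F ∖ F', a clause C satisfying {D ∖ I}
-- turns into ¬I ∪ (C ∖ I), which satisfies F.  Finally F'' is always unsatisfiable, since
-- any clause meeting I meets every clause of F'.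
module Submission where

open import Defs
open import Data.Integer using (-_)
open import Data.Integer.Properties using (neg-involutive)
open import Data.List using ([]; _∷_; _++_; map)
open import Data.List.Membership.Propositional using (_∈_; _∉_; find)
open import Data.List.Membership.Propositional.Properties
  using (∈-++⁻; ∈-++⁺ˡ; ∈-++⁺ʳ; ∈-filter⁻; ∈-filter⁺; ∈-map⁺; ∈-map⁻)
open import Data.List.Relation.Binary.Subset.Propositional using (_⊆_)
import Data.List.Relation.Unary.All as All
open import Data.List.Relation.Unary.All.Properties using (++⁺; anti-mono)
open import Data.List.Relation.Unary.Any as Any using (here; there)
open import Data.Product using (_×_; _,_; proj₁; proj₂)
open import Data.Sum using (inj₁; inj₂)
open import Data.Empty using (⊥-elim)
open import Function.Bundles using (_⇔_; mk⇔)
open import Relation.Binary.PropositionalEquality using (_≢_; refl; sym; cong; subst)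
open import Relation.Nullary using (¬_; yes; no)
open import Relation.Nullary.Decidable using (¬?)
import Data.Integer as ℤ
open import Data.List.Membership.DecPropositional ℤ._≟_ using (_∈?_)

negate : Clause → Clause
negate = map -_

∈-negate⁺ : ∀ {x C} → - x ∈ C → x ∈ negate C
∈-negate⁺ {x} -x∈C = subst (_∈ _) (neg-involutive x) (∈-map⁺ -_ -x∈C)

∈-negate⁻ : ∀ {x C} → x ∈ negate C → - x ∈ C
∈-negate⁻ x∈ with ∈-map⁻ -_ x∈
... | z , z∈C , refl = subst (_∈ _) (sym (neg-involutive z)) z∈C

Clash-sym : ∀ {C D} → Clash C D → Clash D C
Clash-sym (x , x∈C , -x∈D) = - x , -x∈D , subst (_∈ _) (sym (neg-involutive x)) x∈C

Meets-⊆ : ∀ {C D E} → D ⊆ E → Meets C D → Meets C E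
Meets-⊆ D⊆E (x , x∈C , x∈D) = x , x∈C , D⊆E x∈D

IsClause-⊆ : ∀ {C D} → D ⊆ C → IsClause C → IsClause D
IsClause-⊆ D⊆C (nonzero , consistent) =
  anti-mono D⊆C nonzero ,
  λ x x∈D -x∈D → consistent x (D⊆C x∈D) (D⊆C -x∈D)

IsClause-negate : ∀ {C} → IsClause C → IsClause (negate C)
IsClause-negate (nonzero , consistent) =
  All.tabulate (λ x∈ x≡0 → All.lookup nonzero (∈-negate⁻ x∈) (cong -_ x≡0)) ,
  λ x x∈ -x∈ → consistent (- x) (∈-negate⁻ x∈) (∈-negate⁻ -x∈)

IsClause-++ : ∀ {A B} → IsClause A → IsClause B → (∀ {x} → x ∈ A → - x ∉ B) →
              IsClause (A ++ B)
IsClause-++ {A} (nzA , conA) (nzB , conB) apart = ++⁺ nzA nzB , consistent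
  where
  consistent : ∀ x → x ∈ A ++ _ → - x ∉ A ++ _
  consistent x x∈ -x∈ with ∈-++⁻ A x∈ | ∈-++⁻ A -x∈
  ... | inj₁ x∈A | inj₁ -x∈A = conA x x∈A -x∈A
  ... | inj₁ x∈A | inj₂ -x∈B = apart x∈A -x∈B
  ... | inj₂ x∈B | inj₁ -x∈A = apart -x∈A (subst (_∈ _) (sym (neg-involutive x)) x∈B)
  ... | inj₂ x∈B | inj₂ -x∈B = conB x x∈B -x∈B

∈-∖ᶜ⁻ : ∀ {x} D C → x ∈ D ∖ᶜ C → x ∈ D × x ∉ C
∈-∖ᶜ⁻ D C = ∈-filter⁻ (λ y → ¬? (y ∈? C)) {xs = D}

∈-∖ᶜ⁺ : ∀ {x D C} → x ∈ D → x ∉ C → x ∈ D ∖ᶜ C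
∈-∖ᶜ⁺ = ∈-filter⁺ (λ y → ¬? (y ∈? _))

∈-∖ₛ⁻ : ∀ {E} F F' → E ∈ F ∖ₛ F' → E ∈ F × ¬ E ∈ₛ F'
∈-∖ₛ⁻ F F' = ∈-filter⁻ (λ D → ¬? (D ∈ₛ? F')) {xs = F}

∈-∖ₛ⁺ : ∀ {E F F'} → E ∈ F → ¬ E ∈ₛ F' → E ∈ F ∖ₛ F'
∈-∖ₛ⁺ = ∈-filter⁺ (λ D → ¬? (D ∈ₛ? _))

∖ₛ-⊆ : ∀ F F' → F ∖ₛ F' ⊆ F
∖ₛ-⊆ F F' E∈ = proj₁ (∈-∖ₛ⁻ F F' E∈)

∖ₛ-distinct : ∀ {D E F'} F → D ∈ F' → E ∈ F ∖ₛ F' → ¬ D ≐ E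
∖ₛ-distinct {F' = F'} F D∈F' E∈ D≐E = proj₂ (∈-∖ₛ⁻ F F' E∈) (Any.map (λ { refl → D≐E }) D∈F')

⋂-⊆ : ∀ {D F} → D ∈ F → ⋂ F ⊆ D
⋂-⊆ {F = D₀ ∷ Fs} D∈F x∈⋂ with ∈-filter⁻ (λ x → All.all? (λ D → x ∈? D) Fs) {xs = D₀} x∈⋂
... | x∈D₀ , x∈Fs with D∈F
... | here refl   = x∈D₀
... | there D∈Fs = All.lookup x∈Fs D∈Fs

IsClause-⋂ : ∀ {F} → IsClauseSet F → IsClause (⋂ F)
IsClause-⋂ {[]}    _               = All.[] , λ _ ()
IsClause-⋂ {_ ∷ _} (C-clause All.∷ _) = IsClause-⊆ (⋂-⊆ (here refl)) C-clause

MeetsAll : Clause → ClauseSet → Set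
MeetsAll C F = ∀ D → D ∈ F → Meets C D

MeetsAll-∖ₛ : ∀ {C F F'} → MeetsAll C F' → MeetsAll C (F ∖ₛ F') → MeetsAll C F
MeetsAll-∖ₛ {F' = F'} meets-F' meets-rest D D∈F with D ∈ₛ? F'
... | no D∉F' = meets-rest D (∈-∖ₛ⁺ D∈F D∉F')
... | yes D∈F' with find D∈F'
...   | D' , D'∈F' , (D'⊆D , _) = Meets-⊆ D'⊆D (meets-F' D' D'∈F')

contractFactor-unsatisfiable : ∀ {F F'} → Unsatisfiable F → Unsatisfiable (contractFactor F F')
contractFactor-unsatisfiable {F} {F'} unsat (C , C-clause , meets) =
  unsat (C , C-clause , MeetsAll-∖ₛ meets-F' (λ E E∈ → meets E (∈-++⁺ˡ E∈)))
  where
  meets-F' : MeetsAll C F'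
  meets-F' D D∈F' = Meets-⊆ (⋂-⊆ D∈F') (meets (⋂ F') (∈-++⁺ʳ (F ∖ₛ F') (here refl)))

ClashesOutside : ClauseSet → ClauseSet → Set
ClashesOutside F F' = ∀ {E} → E ∈ F ∖ₛ F' → Clash (⋂ F') E

factor⇒clashesOutside : ∀ {F F'} → IsClauseSet F → Hitting F → F' ⊆ F →
                        Unsatisfiable (map (λ D → D ∖ᶜ ⋂ F') F') → ClashesOutside F F'
factor⇒clashesOutside {F} {F'} F-clauses hitting F'⊆F unsat {E} E∈
  with Any.any? (λ x → - x ∈? E) (⋂ F')
... | yes clash = find clash
... | no ¬clash = ⊥-elim (unsat (negate E , IsClause-negate (All.lookup F-clauses E∈F) , meets))
  where
  E∈F : E ∈ F
  E∈F = ∖ₛ-⊆ F F' E∈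
  meets : MeetsAll (negate E) (map (λ D → D ∖ᶜ ⋂ F') F')
  meets _ D∖⋂∈ with ∈-map⁻ (λ D → D ∖ᶜ ⋂ F') D∖⋂∈
  ... | D , D∈F' , refl with hitting D E (F'⊆F D∈F') E∈F (∖ₛ-distinct F D∈F' E∈)
  ...   | x , x∈D , -x∈E =
    x , ∈-negate⁺ -x∈E , ∈-∖ᶜ⁺ x∈D (λ x∈⋂ → ¬clash (Any.map (λ { refl → -x∈E }) x∈⋂))

falsify : Clause → Clause → Clause
falsify I C = negate I ++ (C ∖ᶜ I)

IsClause-falsify : ∀ {I C} → IsClause I → IsClause C → IsClause (falsify I C)
IsClause-falsify {I} {C} I-clause C-clause =
  IsClause-++ (IsClause-negate I-clause) (IsClause-⊆ (λ x∈ → proj₁ (∈-∖ᶜ⁻ C I x∈)) C-clause)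
              (λ x∈ -x∈ → proj₂ (∈-∖ᶜ⁻ C I -x∈) (∈-negate⁻ x∈))

clashesOutside⇒factor : ∀ {F F'} → IsClauseSet F → Unsatisfiable F → F' ⊆ F →
                        ClashesOutside F F' → Unsatisfiable (map (λ D → D ∖ᶜ ⋂ F') F')
clashesOutside⇒factor {F} {F'} F-clauses unsat F'⊆F clashes (C , C-clause , meets) =
  unsat (falsify (⋂ F') C ,
         IsClause-falsify (IsClause-⋂ (anti-mono F'⊆F F-clauses)) C-clause ,
         MeetsAll-∖ₛ meets-F' meets-rest)
  where
  meets-F' : MeetsAll (falsify (⋂ F') C) F'
  meets-F' D D∈F' with meets (D ∖ᶜ ⋂ F') (∈-map⁺ (λ D → D ∖ᶜ ⋂ F') D∈F')
  ... | y , y∈C , y∈D∖⋂ with ∈-∖ᶜ⁻ D (⋂ F') y∈D∖⋂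
  ...   | y∈D , y∉⋂ = y , ∈-++⁺ʳ (negate (⋂ F')) (∈-∖ᶜ⁺ y∈C y∉⋂) , y∈D
  meets-rest : MeetsAll (falsify (⋂ F') C) (F ∖ₛ F')
  meets-rest E E∈ with clashes E∈
  ... | x , x∈⋂ , -x∈E = - x , ∈-++⁺ˡ (∈-map⁺ -_ x∈⋂) , -x∈E

clashesOutside⇒hitting : ∀ {F F'} → Hitting F → ClashesOutside F F' → Hitting (contractFactor F F')
clashesOutside⇒hitting {F} {F'} hitting clashes C D C∈ D∈ C≉D
  with ∈-++⁻ (F ∖ₛ F') C∈ | ∈-++⁻ (F ∖ₛ F') D∈
... | inj₁ C∈rest      | inj₁ D∈rest      = hitting C D (∖ₛ-⊆ F F' C∈rest) (∖ₛ-⊆ F F' D∈rest) C≉D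
... | inj₁ C∈rest      | inj₂ (here refl) = Clash-sym (clashes C∈rest)
... | inj₂ (here refl) | inj₁ D∈rest      = clashes D∈rest
... | inj₂ (here refl) | inj₂ (here refl) = ⊥-elim (C≉D ((λ x∈ → x∈) , (λ x∈ → x∈)))

-- ⋂ F' ≐ E is excluded because E clashes with a clause of F' containing ⋂ F'.
hitting⇒clashesOutside : ∀ {F F' D} → IsClauseSet F → Hitting F → F' ⊆ F → D ∈ F' →
                         Hitting (contractFactor F F') → ClashesOutside F F'
hitting⇒clashesOutside {F} {F'} {D} F-clauses hitting F'⊆F D∈F' hitting'' {E} E∈ =
  hitting'' (⋂ F') E (∈-++⁺ʳ (F ∖ₛ F') (here refl)) (∈-++⁺ˡ E∈) ⋂≉E
  where
  ⋂≉E : ¬ ⋂ F' ≐ E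
  ⋂≉E (_ , E⊆⋂) with hitting D E (F'⊆F D∈F') (∖ₛ-⊆ F F' E∈) (∖ₛ-distinct F D∈F' E∈)
  ... | x , x∈D , -x∈E = proj₂ (All.lookup F-clauses (F'⊆F D∈F')) x x∈D (⋂-⊆ D∈F' (E⊆⋂ -x∈E))

lemma13 : (F F' : ClauseSet) → IsClauseSet F → Unsatisfiable F → Hitting F →
    F' ⊆ F → F' ≢ [] →
    (IsClauseFactor F' ⇔ Hitting (contractFactor F F'))
    × (Hitting (contractFactor F F') ⇔
    (Unsatisfiable (contractFactor F F') × Hitting (contractFactor F F')))
lemma13 F []      _         _     _       _    F'≢[] = ⊥-elim (F'≢[] refl)
lemma13 F (D ∷ _) F-clauses unsat hitting F'⊆F F'≢[] =
  mk⇔ (λ (_ , factor) → clashesOutside⇒hitting hitting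
                           (factor⇒clashesOutside F-clauses hitting F'⊆F factor))
      (λ hitting'' → F'≢[] , clashesOutside⇒factor F-clauses unsat F'⊆F
                               (hitting⇒clashesOutside F-clauses hitting F'⊆F (here refl) hitting''))
  ,
  mk⇔ (λ hitting'' → contractFactor-unsatisfiable unsat , hitting'') proj₂
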